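{- Let $r \geqslant 0$ be an integer, and let $t \geqslant 2$ and $1 \leqslant n_1 \leqslant n_2 \leqslant \cdots \leqslant n_t$ be integers. Let $\theta = \max\{ m \in \mathbb{N} : \lfloor n_i/m \rfloor \geqslant \lceil n_i/(m+r) \rceil \text{ for all } 1 \leqslant i \leqslant t\}$. Then $\chi_{r=}(K_{n_1,n_2,\ldots,n_t}) = \sum_{i=1}^t \lceil n_i/(\theta+r) \rceil$.
   Context: All graphs are finite, simple and undirected; $\mathbb{N}$ is the set of positive integers. For a positive integer $k$, a (proper) $k$-coloring of a graph $G=(V,E)$ is a map $f: V \to \{1,\ldots,k\}$ with $f(u)\neq f(v)$ whenever $uv \in E$; the color classes are the sets $\{u \in V : f(u)=c\}$ for $c=1,\ldots,k$, and these may be empty. For an integer $r \geqslant 0$, a $k$-coloring is $r$-equitable if the sizes of any two of its $k$ color classes (including empty ones) differ by at most $r$. The $r$-equitable chromatic number $\chi_{r=}(G)$ is the least positive integer $k$ such that $G$ has an $r$-equitable $k$-coloring. $K_{n_1,\ldots,n_t}$ denotes the complete $t$-partite graph whose vertex set is partitioned into independent sets $V_1,\ldots,V_t$ with $|V_i|=n_i$, every vertex of $V_i$ adjacent to every vertex of $V_j$ for $i \neq j$. -}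

module Defs where

open import Data.Nat using (ℕ; zero; suc; _+_; _≤_; _<_; _/_)
open import Data.Fin using (Fin) renaming (_≤_ to _≤ᶠ_)
import Data.Fin as F
open import Data.Fin.Properties using () renaming (_≟_ to _≟ᶠ_)
open import Data.List using (List; length; filter; map; allFin)
open import Data.Nat.ListAction using (sum)
open import Data.Product using (Σ; _×_; _,_; ∃-syntax)
open import Relation.Binary.PropositionalEquality using (_≡_; _≢_)
open import Relation.Nullary using (¬_)

-- Ceiling division ⌈ a / d ⌉ for d ≥ 1 (value at d = 0 is a junk 0, never used:
-- every use below has a positive divisor).
⌈_/_⌉ : ℕ → ℕ → ℕ
⌈ a / zero ⌉ = 0
⌈ a / suc d ⌉ = (a + d) / suc d

-- Floor division ⌊ a / d ⌋ for d ≥ 1 (junk 0 at d = 0, never used).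
⌊_/_⌋ : ℕ → ℕ → ℕ
⌊ a / zero ⌋ = 0
⌊ a / suc d ⌋ = a / suc d

-- The complete t-partite graph K_{n_1,...,n_t}, part sizes n : Fin t → ℕ.

Vertex : (t : ℕ) → (Fin t → ℕ) → Set
Vertex t n = Σ (Fin t) (λ i → Fin (n i))

Adj : {t : ℕ} {n : Fin t → ℕ} → Vertex t n → Vertex t n → Set
Adj (i , _) (j , _) = i ≢ j

IsColoring : {t : ℕ} (n : Fin t → ℕ) (k : ℕ) → (Vertex t n → Fin k) → Set
IsColoring {t} n k f = (u v : Vertex t n) → Adj {t} {n} u v → f u ≢ f v

classSize : {t : ℕ} (n : Fin t → ℕ) {k : ℕ} → (Vertex t n → Fin k) → Fin k → ℕ
classSize {t} n f c =
  sum (map (λ i → length (filter (λ a → f (i , a) ≟ᶠ c) (allFin (n i)))) (allFin t))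

-- r-equitable: any two color classes (empty ones included) differ by at most r.
IsREquitable : {t : ℕ} (n : Fin t → ℕ) (r k : ℕ) → (Vertex t n → Fin k) → Set
IsREquitable n r k f = (c d : Fin k) → classSize n f c ≤ classSize n f d + r

HasREqColoring : {t : ℕ} (n : Fin t → ℕ) (r k : ℕ) → Set
HasREqColoring {t} n r k =
  Σ (Vertex t n → Fin k) (λ f → IsColoring n k f × IsREquitable n r k f)

IsREqChromaticNumber : {t : ℕ} (n : Fin t → ℕ) (r k : ℕ) → Set
IsREqChromaticNumber n r k =
  1 ≤ k × HasREqColoring n r k × ((k' : ℕ) → 1 ≤ k' → k' < k → ¬ HasREqColoring n r k')

ThetaCond : {t : ℕ} (n : Fin t → ℕ) (r m : ℕ) → Set
ThetaCond {t} n r m = 1 ≤ m × ((i : Fin t) → ⌈ n i / (m + r) ⌉ ≤ ⌊ n i / m ⌋)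

IsTheta : {t : ℕ} (n : Fin t → ℕ) (r θ : ℕ) → Set
IsTheta n r θ = ThetaCond n r θ × ((m : ℕ) → θ < m → ¬ ThetaCond n r m)

-- In a proper colouring of a complete multipartite graph every colour class lies
-- inside a single part. If all classes of an r-equitable colouring have between m ≥ 1
-- and m + r vertices, a part of size n_i carrying u_i colours satisfies
-- ⌈n_i/(m+r)⌉ ≤ u_i ≤ ⌊n_i/m⌋, so m obeys the condition defining θ and m ≤ θ.
-- Applied to the smallest class, this bounds every class by θ + r, so part i needs at
-- least ⌈n_i/(θ+r)⌉ colours. Conversely, giving part i its own ⌈n_i/(θ+r)⌉ colours
-- and colouring its a-th vertex by a mod ⌈n_i/(θ+r)⌉ yields classes of size between
-- θ and θ + r, because ⌈n_i/(θ+r)⌉ ≤ ⌊n_i/θ⌋.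

module Submission where

open import Defs
open import Data.Bool.Base using (if_then_else_)
open import Data.Fin using (Fin; zero; suc; toℕ; _↑ˡ_; _↑ʳ_; splitAt) renaming (_≤_ to _≤ᶠ_)
open import Data.Fin.Properties
  using (toℕ<n; fromℕ<-cong; fromℕ<-toℕ; splitAt-↑ˡ; splitAt-↑ʳ; splitAt⁻¹-↑ˡ; splitAt⁻¹-↑ʳ)
  renaming (_≟_ to _≟ᶠ_; suc-injective to fsuc-injective)
open import Data.List using (length; filter; map; allFin; tabulate)
open import Data.List.Extrema.Nat using (argmin; f[argmin]≤f[xs])
open import Data.List.Membership.Propositional.Properties using (∈-allFin)
open import Data.List.Properties using (map-tabulate)
import Data.List.Relation.Unary.All as All
open import Data.Nat
  using (ℕ; zero; suc; _+_; _*_; _∸_; _≤_; _<_; _<?_; z≤n; s≤s; z<s; NonZero; >-nonZero)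
open import Data.Nat.DivMod
open import Data.Nat.ListAction using (sum)
open import Data.Nat.Properties
open import Data.Product using (Σ; ∃; _×_; _,_; proj₁; proj₂; uncurry)
import Data.Product as Product
open import Data.Sum using (inj₁; inj₂; [_,_]′)
open import Function using (_∘_; id; _⇔_; mk⇔)
open import Relation.Binary.PropositionalEquality
open import Relation.Nullary using (¬_; Dec; yes; no; does; contradiction)
open import Relation.Nullary.Decidable using (dec-true; does-⇔)
open import Relation.Unary using (Pred; Decidable)

open import Algebra.Properties.Semiring.Sum +-*-semiring
  using (sum-syntax; ∑-comm; sum-cong-≗; sum-replicate-zero; sum-remove; *-distribʳ-sum)
  renaming (sum to ∑)

private
  variable
    n t : ℕ

⌈/⌉-least : ∀ a u d → a ≤ u * suc d → ⌈ a / suc d ⌉ ≤ u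
⌈/⌉-least a u d a≤ud = ≤-pred (m<n*o⇒m/o<n (begin-strict
  a + d             ≤⟨ +-monoˡ-≤ d a≤ud ⟩
  u * suc d + d     <⟨ +-monoʳ-< (u * suc d) (n<1+n d) ⟩
  u * suc d + suc d ≡⟨ +-comm (u * suc d) (suc d) ⟩
  suc u * suc d     ∎))
  where open ≤-Reasoning

≤⌈/⌉* : ∀ a d → a ≤ ⌈ a / suc d ⌉ * suc d
≤⌈/⌉* a d = +-cancelʳ-≤ d a _ (begin
  a + d                       ≡⟨ m≡m%n+[m/n]*n (a + d) (suc d) ⟩
  (a + d) % suc d + q * suc d ≤⟨ +-monoˡ-≤ (q * suc d) (≤-pred (m%n<n (a + d) (suc d))) ⟩
  d + q * suc d               ≡⟨ +-comm d _ ⟩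
  q * suc d + d               ∎)
  where
  q = ⌈ a / suc d ⌉
  open ≤-Reasoning

⌈/⌉-pos : ∀ a d → 1 ≤ a → 1 ≤ ⌈ a / suc d ⌉
⌈/⌉-pos a d 1≤a = m≥n⇒m/n>0 (+-monoˡ-≤ d 1≤a)

*≤⇒≤⌊/⌋ : ∀ a u d → u * suc d ≤ a → u ≤ ⌊ a / suc d ⌋
*≤⇒≤⌊/⌋ a u d ud≤a = subst (_≤ a / suc d) (m*n/n≡m u (suc d)) (/-monoˡ-≤ (suc d) ud≤a)

≤⌊/⌋⇒*≤ : ∀ a u d → u ≤ ⌊ a / suc d ⌋ → u * suc d ≤ a
≤⌊/⌋⇒*≤ a u d u≤a/d = ≤-trans (*-monoˡ-≤ (suc d) u≤a/d) (m/n*n≤m a (suc d))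

𝟙 : ∀ {p} {P : Set p} → Dec P → ℕ
𝟙 P? = if does P? then 1 else 0

𝟙-yes : ∀ {p} {P : Set p} (P? : Dec P) → P → 𝟙 P? ≡ 1
𝟙-yes P? p = cong (if_then 1 else 0) (dec-true P? p)

𝟙-pos : ∀ {p} {P : Set p} (P? : Dec P) → 0 < 𝟙 P? → P
𝟙-pos (yes p) _ = p

𝟙≤1 : ∀ {p} {P : Set p} (P? : Dec P) → 𝟙 P? ≤ 1
𝟙≤1 (yes _) = ≤-refl
𝟙≤1 (no _)  = z≤n

𝟙-⇔ : ∀ {p q} {P : Set p} {Q : Set q} →
      P ⇔ Q → (P? : Dec P) (Q? : Dec Q) → 𝟙 P? ≡ 𝟙 Q?
𝟙-⇔ P⇔Q P? Q? = cong (if_then 1 else 0) (does-⇔ P⇔Q P? Q?)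

∑-mono-≤ : {f g : Fin n → ℕ} → (∀ i → f i ≤ g i) → ∑ f ≤ ∑ g
∑-mono-≤ {zero}  f≤g = z≤n
∑-mono-≤ {suc n} f≤g = +-mono-≤ (f≤g zero) (∑-mono-≤ (f≤g ∘ suc))

≤-∑ : (f : Fin n → ℕ) (i : Fin n) → f i ≤ ∑ f
≤-∑ {suc n} f i = ≤-trans (m≤m+n (f i) _) (≤-reflexive (sym (sum-remove f)))

∑-1 : ∀ n → ∑[ i < n ] 1 ≡ n
∑-1 zero    = refl
∑-1 (suc n) = cong suc (∑-1 n)

∑-pos : (f : Fin n → ℕ) → 0 < ∑ f → ∃ λ i → 0 < f i
∑-pos {suc n} f 0<∑ with f zero in eq
... | suc _ = zero , subst (0 <_) (sym eq) z<s
... | zero  = Product.map suc id (∑-pos (f ∘ suc) 0<∑)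

∑-unique-nonzero : (f : Fin n → ℕ) (i : Fin n) → (∀ j → 0 < f j → j ≡ i) → ∑ f ≡ f i
∑-unique-nonzero {suc n} f zero only-i =
  trans (cong (f zero +_) (trans (sum-cong-≗ vanish) (sum-replicate-zero n))) (+-identityʳ _)
  where
  vanish : ∀ j → f (suc j) ≡ 0
  vanish j = n≤0⇒n≡0 (≮⇒≥ (λ pos → contradiction (only-i (suc j) pos) λ ()))
∑-unique-nonzero {suc n} f (suc i) only-i =
  trans (cong (_+ ∑ (f ∘ suc)) f0≡0)
        (∑-unique-nonzero (f ∘ suc) i (λ j pos → fsuc-injective (only-i (suc j) pos)))
  where
  f0≡0 : f zero ≡ 0
  f0≡0 = n≤0⇒n≡0 (≮⇒≥ (λ pos → contradiction (only-i zero pos) λ ()))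

∑-𝟙-unique : ∀ {p} {P : Pred (Fin n) p} (P? : Decidable P) (i : Fin n) →
             P i → (∀ j → P j → j ≡ i) → ∑[ j < n ] 𝟙 (P? j) ≡ 1
∑-𝟙-unique P? i Pi only-i =
  trans (∑-unique-nonzero (𝟙 ∘ P?) i (λ j pos → only-i j (𝟙-pos (P? j) pos))) (𝟙-yes (P? i) Pi)

∑≤-unique-nonzero : ∀ {b} (f : Fin n → ℕ) → (∀ i j → 0 < f i → 0 < f j → i ≡ j) →
                    (∀ i → f i ≤ b) → ∑ f ≤ b
∑≤-unique-nonzero f unique f≤b with ∑ f in eq
... | zero  = z≤n
... | suc _ with ∑-pos f (subst (0 <_) (sym eq) z<s)
...   | i , pos = subst (_≤ _) ∑f≡fi (f≤b i)
  where ∑f≡fi = trans (sym (∑-unique-nonzero f i (λ j pos′ → unique j i pos′ pos))) eq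

supportSize : (Fin n → ℕ) → ℕ
supportSize f = ∑[ i < _ ] 𝟙 (0 <? f i)

∑≤supportSize* : ∀ {M} (f : Fin n → ℕ) → (∀ i → f i ≤ M) → ∑ f ≤ supportSize f * M
∑≤supportSize* {M = M} f f≤M =
  ≤-trans (∑-mono-≤ (λ i → ≤𝟙* (f i) (f≤M i)))
          (≤-reflexive (sym (*-distribʳ-sum M (λ i → 𝟙 (0 <? f i)))))
  where
  ≤𝟙* : ∀ x → x ≤ M → x ≤ 𝟙 (0 <? x) * M
  ≤𝟙* zero    _   = z≤n
  ≤𝟙* (suc x) x≤M = ≤-trans x≤M (m≤m+n M 0)

supportSize*≤∑ : ∀ {m} (f : Fin n → ℕ) → (∀ i → 0 < f i → m ≤ f i) → supportSize f * m ≤ ∑ f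
supportSize*≤∑ {m = m} f m≤f =
  ≤-trans (≤-reflexive (*-distribʳ-sum m (λ i → 𝟙 (0 <? f i))))
          (∑-mono-≤ (λ i → 𝟙*≤ (f i) (m≤f i)))
  where
  𝟙*≤ : ∀ x → (0 < x → m ≤ x) → 𝟙 (0 <? x) * m ≤ x
  𝟙*≤ zero    _   = z≤n
  𝟙*≤ (suc x) m≤x = subst (_≤ suc x) (sym (+-identityʳ m)) (m≤x z<s)

sum-tabulate : (f : Fin n → ℕ) → sum (tabulate f) ≡ ∑ f
sum-tabulate {zero}  f = refl
sum-tabulate {suc n} f = cong (f zero +_) (sum-tabulate (f ∘ suc))

sum-map-allFin : (f : Fin n → ℕ) → sum (map f (allFin n)) ≡ ∑ f
sum-map-allFin f = trans (cong sum (map-tabulate id f)) (sum-tabulate f)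

length-filter-tabulate : ∀ {a p} {A : Set a} {P : Pred A p}
                         (P? : Decidable P) (h : Fin n → A) →
                         length (filter P? (tabulate h)) ≡ ∑[ i < n ] 𝟙 (P? (h i))
length-filter-tabulate {zero}  P? h = refl
length-filter-tabulate {suc n} P? h with P? (h zero)
... | yes _ = cong suc (length-filter-tabulate P? (h ∘ suc))
... | no _  = length-filter-tabulate P? (h ∘ suc)

∑-split : ∀ m n (h : ℕ → ℕ) →
          ∑[ a < m + n ] h (toℕ a) ≡ ∑[ a < m ] h (toℕ a) + ∑[ a < n ] h (m + toℕ a)
∑-split zero    n h = refl
∑-split (suc m) n h = trans (cong (h 0 +_) (∑-split m n (h ∘ suc))) (sym (+-assoc (h 0) _ _))

toℕ-mod : ∀ {k} .{{_ : NonZero k}} (a : Fin k) → toℕ a mod k ≡ a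
toℕ-mod {k} a = trans (fromℕ<-cong _ _ (m<n⇒m%n≡m (toℕ<n a)) (m%n<n (toℕ a) k) (toℕ<n a))
                      (fromℕ<-toℕ a (toℕ<n a))

mod-periodic : ∀ k y .{{_ : NonZero k}} → (k + y) mod k ≡ y mod k
mod-periodic k y =
  fromℕ<-cong _ _ (trans (%-congˡ (+-comm k y)) ([m+n]%n≡m%n y k)) (m%n<n (k + y) k) (m%n<n y k)

module ResidueCount (k : ℕ) .{{_ : NonZero k}} (q : Fin k) where

  isResidue : ℕ → ℕ
  isResidue y = 𝟙 (y mod k ≟ᶠ q)

  residueCount : ℕ → ℕ
  residueCount x = ∑[ a < x ] isResidue (toℕ a)

  isResidue-periodic : ∀ y → isResidue (k + y) ≡ isResidue y
  isResidue-periodic y = cong (λ r → 𝟙 (r ≟ᶠ q)) (mod-periodic k y)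

  residueCount-period : residueCount k ≡ 1
  residueCount-period = trans (sum-cong-≗ (λ a → cong (λ r → 𝟙 (r ≟ᶠ q)) (toℕ-mod a)))
                              (∑-𝟙-unique (_≟ᶠ q) q refl (λ _ → id))

  residueCount-+ : ∀ x → residueCount (k + x) ≡ suc (residueCount x)
  residueCount-+ x = trans (∑-split k x isResidue)
    (cong₂ _+_ residueCount-period (sum-cong-≗ {n = x} (λ a → isResidue-periodic (toℕ a))))

  residueCount-∸ : ∀ {x} → k ≤ x → residueCount x ≡ suc (residueCount (x ∸ k))
  residueCount-∸ {x} k≤x =
    trans (cong residueCount (sym (m+[n∸m]≡n k≤x))) (residueCount-+ (x ∸ k))

  residueCount-mono : ∀ {x y} → x ≤ y → residueCount x ≤ residueCount y
  residueCount-mono {x} {y} x≤y =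
    subst (λ z → residueCount x ≤ residueCount z) (m+[n∸m]≡n x≤y)
    (subst (residueCount x ≤_) (sym (∑-split x (y ∸ x) isResidue)) (m≤m+n _ _))

  residueCount-lower : ∀ θ {x} → θ * k ≤ x → θ ≤ residueCount x
  residueCount-lower zero    _      = z≤n
  residueCount-lower (suc θ) {x} θk≤x =
    subst (suc θ ≤_) (sym (residueCount-∸ (m+n≤o⇒m≤o k θk≤x)))
      (s≤s (residueCount-lower θ (m+n≤o⇒m≤o∸n (θ * k) (subst (_≤ x) (+-comm k (θ * k)) θk≤x))))

  residueCount-upper : ∀ s {x} → x ≤ s * k → residueCount x ≤ s
  residueCount-upper zero    x≤0 rewrite n≤0⇒n≡0 x≤0 = z≤n
  residueCount-upper (suc s) {x} x≤sk with k ≤? x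
  ... | yes k≤x = subst (_≤ suc s) (sym (residueCount-∸ k≤x))
                    (s≤s (residueCount-upper s (m≤n+o⇒m∸n≤o x k x≤sk)))
  ... | no  k≰x = ≤-trans (residueCount-mono (≰⇒≥ k≰x))
                          (subst (_≤ suc s) (sym residueCount-period) (s≤s z≤n))

embed : (k : Fin t → ℕ) (i : Fin t) → Fin (k i) → Fin (∑ k)
embed {suc t} k zero    q = q ↑ˡ ∑ (k ∘ suc)
embed {suc t} k (suc i) q = k zero ↑ʳ embed (k ∘ suc) i q

unembed : (k : Fin t → ℕ) → Fin (∑ k) → Σ (Fin t) (Fin ∘ k)
unembed {suc t} k c =
  [ (zero ,_) , Product.map suc id ∘ unembed (k ∘ suc) ]′ (splitAt (k zero) c)

unembed-embed : (k : Fin t → ℕ) (i : Fin t) (q : Fin (k i)) →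
                unembed k (embed k i q) ≡ (i , q)
unembed-embed {suc t} k zero    q
  rewrite splitAt-↑ˡ (k zero) q (∑ (k ∘ suc)) = refl
unembed-embed {suc t} k (suc i) q
  rewrite splitAt-↑ʳ (k zero) (∑ (k ∘ suc)) (embed (k ∘ suc) i q)
        | unembed-embed (k ∘ suc) i q = refl

embed-unembed : (k : Fin t → ℕ) (c : Fin (∑ k)) → uncurry (embed k) (unembed k c) ≡ c
embed-unembed {suc t} k c with splitAt (k zero) c in eq
... | inj₁ q  = splitAt⁻¹-↑ˡ eq
... | inj₂ c′ = trans (cong (k zero ↑ʳ_) (embed-unembed (k ∘ suc) c′)) (splitAt⁻¹-↑ʳ eq)

embed-injective : (k : Fin t → ℕ) {i j : Fin t} {q : Fin (k i)} {q′ : Fin (k j)} →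
                  embed k i q ≡ embed k j q′ → (i , q) ≡ (j , q′)
embed-injective k {i} {j} {q} {q′} eq =
  trans (sym (unembed-embed k i q)) (trans (cong (unembed k) eq) (unembed-embed k j q′))

embed-injectiveʳ : (k : Fin t → ℕ) {i : Fin t} {q q′ : Fin (k i)} →
                   embed k i q ≡ embed k i q′ → q ≡ q′
embed-injectiveʳ k eq with embed-injective k eq
... | refl = refl

module ColourClasses {t} (n : Fin t → ℕ) {k} (g : Vertex t n → Fin k) where

  partClassSize : Fin t → Fin k → ℕ
  partClassSize i c = ∑[ a < n i ] 𝟙 (g (i , a) ≟ᶠ c)

  coloursOn : Fin t → ℕ
  coloursOn i = supportSize (partClassSize i)

  classSize≡∑partClassSize : ∀ c → classSize n g c ≡ ∑[ i < t ] partClassSize i c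
  classSize≡∑partClassSize c =
    trans (sum-map-allFin count)
          (sum-cong-≗ (λ i → length-filter-tabulate (λ a → g (i , a) ≟ᶠ c) id))
    where
    count : Fin t → ℕ
    count i = length (filter (λ a → g (i , a) ≟ᶠ c) (allFin (n i)))

  ∑partClassSize : ∀ i → ∑[ c < k ] partClassSize i c ≡ n i
  ∑partClassSize i = begin
    ∑[ c < k ] ∑[ a < n i ] 𝟙 (g (i , a) ≟ᶠ c) ≡⟨ ∑-comm (λ c a → 𝟙 (g (i , a) ≟ᶠ c)) ⟩
    ∑[ a < n i ] ∑[ c < k ] 𝟙 (g (i , a) ≟ᶠ c) ≡⟨ sum-cong-≗ (λ a → oneColour (g (i , a))) ⟩
    ∑[ a < n i ] 1                            ≡⟨ ∑-1 (n i) ⟩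
    n i                                       ∎
    where
    open ≡-Reasoning
    oneColour : ∀ x → ∑[ c < k ] 𝟙 (x ≟ᶠ c) ≡ 1
    oneColour x = ∑-𝟙-unique (x ≟ᶠ_) x refl (λ _ → sym)

  partClassSize-pos : ∀ {i c} → 0 < partClassSize i c → ∃ λ a → g (i , a) ≡ c
  partClassSize-pos {i} {c} pos =
    Product.map₂ (λ {a} → 𝟙-pos (g (i , a) ≟ᶠ c)) (∑-pos _ pos)

  partClassSize≤classSize : ∀ i c → partClassSize i c ≤ classSize n g c
  partClassSize≤classSize i c =
    subst (partClassSize i c ≤_) (sym (classSize≡∑partClassSize c))
          (≤-∑ (λ j → partClassSize j c) i)

  classSize≡partClassSize : ∀ {i c} → (∀ j b → g (j , b) ≡ c → j ≡ i) →
                            classSize n g c ≡ partClassSize i c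
  classSize≡partClassSize {i} {c} only-i = trans (classSize≡∑partClassSize c)
    (∑-unique-nonzero (λ j → partClassSize j c) i
                      (λ j pos → uncurry (only-i j) (partClassSize-pos pos)))

  size≤coloursOn* : ∀ {M} → (∀ c → classSize n g c ≤ M) → ∀ i → n i ≤ coloursOn i * M
  size≤coloursOn* {M} classSize≤M i = subst (_≤ coloursOn i * M) (∑partClassSize i)
    (∑≤supportSize* (partClassSize i)
                    (λ c → ≤-trans (partClassSize≤classSize i c) (classSize≤M c)))

  module Proper (proper : IsColoring n k g) where

    samePart : ∀ {i j a b c} → g (i , a) ≡ c → g (j , b) ≡ c → j ≡ i
    samePart {i} {j} {a} {b} gia≡c gjb≡c with j ≟ᶠ i
    ... | yes j≡i = j≡i
    ... | no  j≢i = contradiction (trans gjb≡c (sym gia≡c)) (proper (j , b) (i , a) j≢i)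

    classSize≡partClassSize-pos : ∀ {i c} → 0 < partClassSize i c →
                                  classSize n g c ≡ partClassSize i c
    classSize≡partClassSize-pos pos with partClassSize-pos pos
    ... | a , gia≡c = classSize≡partClassSize (λ j b → samePart gia≡c)

    coloursOn*≤size : ∀ {m} → (∀ c → m ≤ classSize n g c) → ∀ i → coloursOn i * m ≤ n i
    coloursOn*≤size {m} m≤classSize i = subst (coloursOn i * m ≤_) (∑partClassSize i)
      (supportSize*≤∑ (partClassSize i)
        (λ c pos → subst (m ≤_) (classSize≡partClassSize-pos pos) (m≤classSize c)))

    ∑coloursOn≤ : ∑[ i < t ] coloursOn i ≤ k
    ∑coloursOn≤ = begin
      ∑[ i < t ] ∑[ c < k ] used i c ≡⟨ ∑-comm used ⟩
      ∑[ c < k ] ∑[ i < t ] used i c ≤⟨ ∑-mono-≤ atMostOnePart ⟩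
      ∑[ c < k ] 1                   ≡⟨ ∑-1 k ⟩
      k                              ∎
      where
      open ≤-Reasoning
      used : Fin t → Fin k → ℕ
      used i c = 𝟙 (0 <? partClassSize i c)
      unique : ∀ c i j → 0 < used i c → 0 < used j c → i ≡ j
      unique c i j posᵢ posⱼ
        with partClassSize-pos (𝟙-pos (0 <? _) posᵢ) | partClassSize-pos (𝟙-pos (0 <? _) posⱼ)
      ... | a , gia≡c | b , gjb≡c = samePart gjb≡c gia≡c
      atMostOnePart : ∀ c → ∑[ i < t ] used i c ≤ 1
      atMostOnePart c =
        ∑≤-unique-nonzero (λ i → used i c) (unique c) (λ i → 𝟙≤1 (0 <? partClassSize i c))

module _ {t} (n : Fin t → ℕ) (r : ℕ) {k} {g : Vertex t n → Fin k} (proper : IsColoring n k g) where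
  open ColourClasses n g
  open Proper proper

  thetaCond-of-classSizes : ∀ m → (∀ c → suc m ≤ classSize n g c) →
                            (∀ c → classSize n g c ≤ suc m + r) → ThetaCond n r (suc m)
  thetaCond-of-classSizes m lo hi = s≤s z≤n , λ i →
    ≤-trans (⌈/⌉-least (n i) (coloursOn i) (m + r) (size≤coloursOn* hi i))
            (*≤⇒≤⌊/⌋ (n i) (coloursOn i) m (coloursOn*≤size lo i))

  classSize≤θ+r : ∀ θ → (∀ m → θ < m → ¬ ThetaCond n r m) → IsREquitable n r k g →
                  ∀ c → classSize n g c ≤ θ + r
  classSize≤θ+r θ θ-max equitable c =
    ≤-trans (equitable c c₀)
            (+-monoˡ-≤ r (min≤θ (classSize n g c₀) c₀-min (λ d → equitable d c₀)))
    where
    c₀ : Fin k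
    c₀ = argmin (classSize n g) c (allFin k)
    c₀-min : ∀ d → classSize n g c₀ ≤ classSize n g d
    c₀-min d = All.lookup (f[argmin]≤f[xs] {f = classSize n g} c (allFin k)) (∈-allFin d)
    min≤θ : ∀ m → (∀ d → m ≤ classSize n g d) → (∀ d → classSize n g d ≤ m + r) → m ≤ θ
    min≤θ zero    _  _  = z≤n
    min≤θ (suc m) lo hi = ≮⇒≥ (λ θ<m → θ-max (suc m) θ<m (thetaCond-of-classSizes m lo hi))

  ∑⌈/⌉≤colours : ∀ d → (∀ c → classSize n g c ≤ suc d) → ∑[ i < t ] ⌈ n i / suc d ⌉ ≤ k
  ∑⌈/⌉≤colours d bound =
    ≤-trans (∑-mono-≤ (λ i → ⌈/⌉-least (n i) (coloursOn i) d (size≤coloursOn* bound i)))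
            ∑coloursOn≤

module RoundRobin {t} (n k : Fin t → ℕ) (k>0 : ∀ i → 0 < k i) where
  open ResidueCount using (residueCount; residueCount-lower; residueCount-upper)

  private instance
    k≢0 : ∀ {i} → NonZero (k i)
    k≢0 {i} = >-nonZero (k>0 i)

  colour : Vertex t n → Fin (∑ k)
  colour (i , a) = embed k i (toℕ a mod k i)

  proper : IsColoring n (∑ k) colour
  proper (i , a) (j , b) i≢j eq = i≢j (cong proj₁ (embed-injective k eq))

  classSize-embed : ∀ i q → classSize n colour (embed k i q) ≡ residueCount (k i) q (n i)
  classSize-embed i q =
    trans (classSize≡partClassSize (λ j b eq → cong proj₁ (embed-injective k eq)))
    (sum-cong-≗ (λ a → 𝟙-⇔ (mk⇔ (embed-injectiveʳ k) (cong (embed k i)))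
                          (colour (i , a) ≟ᶠ embed k i q) (toℕ a mod k i ≟ᶠ q)))
    where open ColourClasses n colour

  classSize-bounds : ∀ {m M} → (∀ i → m * k i ≤ n i) → (∀ i → n i ≤ M * k i) →
                     ∀ c → m ≤ classSize n colour c × classSize n colour c ≤ M
  classSize-bounds {m} {M} lo hi c with unembed k c | embed-unembed k c
  ... | i , q | refl rewrite classSize-embed i q =
    residueCount-lower (k i) q m (lo i) , residueCount-upper (k i) q M (hi i)

hasREqColoring-∑⌈/⌉ : ∀ {t} (n : Fin t → ℕ) r θ → (∀ i → 1 ≤ n i) → ThetaCond n r (suc θ) →
                      HasREqColoring n r (∑[ i < t ] ⌈ n i / suc θ + r ⌉)
hasREqColoring-∑⌈/⌉ n r θ n>0 (_ , cond) = colour , proper , equitable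
  where
  κ : Fin _ → ℕ
  κ i = ⌈ n i / suc θ + r ⌉
  open RoundRobin n κ (λ i → ⌈/⌉-pos (n i) (θ + r) (n>0 i))
  bounds : ∀ c → suc θ ≤ classSize n colour c × classSize n colour c ≤ suc θ + r
  bounds = classSize-bounds
    (λ i → subst (_≤ n i) (*-comm (κ i) (suc θ)) (≤⌊/⌋⇒*≤ (n i) (κ i) θ (cond i)))
    (λ i → subst (n i ≤_) (*-comm (κ i) (suc θ + r)) (≤⌈/⌉* (n i) (θ + r)))
  equitable : IsREquitable n r (∑ κ) colour
  equitable c d = ≤-trans (proj₂ (bounds c)) (+-monoˡ-≤ r (proj₁ (bounds d)))

theorem11 : (r t : ℕ) → 2 ≤ t → (n : Fin t → ℕ)
    → ((i : Fin t) → 1 ≤ n i)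
    → ((i j : Fin t) → i ≤ᶠ j → n i ≤ n j)
    → (θ : ℕ) → IsTheta n r θ
    → IsREqChromaticNumber n r (sum (map (λ i → ⌈ n i / (θ + r) ⌉) (allFin t)))
theorem11 r (suc t) _ n n>0 _ zero    ((() , _) , _)
theorem11 r (suc t) _ n n>0 _ (suc θ) (θ-cond , θ-max) =
  subst (IsREqChromaticNumber n r) (sym (sum-map-allFin (λ i → ⌈ n i / suc θ + r ⌉)))
    ( ≤-trans (⌈/⌉-pos (n zero) (θ + r) (n>0 zero)) (m≤m+n _ _)
    , hasREqColoring-∑⌈/⌉ n r θ n>0 θ-cond
    , λ k _ k<∑ (g , proper , equitable) → <⇒≱ k<∑
        (∑⌈/⌉≤colours n r proper (θ + r) (classSize≤θ+r n r proper (suc θ) θ-max equitable)) )
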